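{- Let $N$ be a positive integer and let $\mathcal{F}$ be a set of finite binary words such that for each $i\geq 1$, the number of words of length $i$ in $\mathcal{F}$ is at most $N$. Suppose a finite word $w$ is written as $w=u_1u_2\cdots u_t$ where $u_1,\dots,u_t$ are pairwise distinct elements of $\mathcal{F}$. Then $t\leq 2\sqrt{N|w|}$. -}

module Defs where

open import Data.Bool using (Bool)
open import Data.List using (List; length)
open import Data.List.Relation.Unary.All using (All)
open import Data.List.Relation.Unary.Unique.Propositional using (Unique)
open import Data.Nat using (ℕ; _≤_)
open import Data.Product using (_×_)
open import Relation.Binary.PropositionalEquality using (_≡_)

Word : Set
Word = List Bool

-- "For each i ≥ 1, the number of words of length i in F is at most N":
-- every list of pairwise distinct words of length i lying in F has length ≤ N.
AtMostPerLength : ℕ → (Word → Set) → Set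
AtMostPerLength N F =
  ∀ (i : ℕ) → 1 ≤ i → (ws : List Word) → Unique ws →
  All (λ u → F u × length u ≡ i) ws → length ws ≤ N

module Submission where

-- Let t be the number of
-- distinct factors u₁,…,u_t of w and fix a threshold k.  Since F contains no
-- empty word and at most N words of each length i ≥ 1, at most N·k factors have
-- length ≤ k; hence at least t − N·k factors are "long" (length ≥ k + 1), and
-- |w| ≥ (k + 1)·(t − N·k).  Choosing k = ⌊t / 2N⌋ and writing t = 2N·k + r
-- with r < 2N, this gives 4N·|w| ≥ 4N·(k + 1)·(N·k + r) ≥ (2N·k + r)² = t².

open import Data.Bool using (true; false)
open import Data.List using (List; []; _∷_; length; concat; filter; _++_)
open import Data.List.Properties using (length-++; filter-accept; filter-all)
open import Data.List.Relation.Unary.All as All using (All; []; _∷_; zip)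
import Data.List.Relation.Unary.All.Properties as AllP
open import Data.List.Relation.Unary.Unique.Propositional using (Unique)
import Data.List.Relation.Unary.Unique.Propositional.Properties as Unique
open import Data.Nat using (ℕ; zero; suc; _+_; _*_; _≤_; _<_; z≤n; s≤s; _<?_; _≟_; _/_; _%_)
open import Data.Nat.DivMod using (m≡m%n+[m/n]*n; m%n<n)
open import Data.Nat.Properties
open import Data.Nat.Tactic.RingSolver using (solve-∀)
open import Data.Product using (_,_)
open import Data.Sum using (_⊎_; inj₁; inj₂)
open import Level using (Level)
open import Relation.Nullary using (¬_; yes; no; does; contradiction)
open import Relation.Unary using (Pred; Decidable)
open import Relation.Binary.PropositionalEquality using (_≡_; refl; sym; trans; cong)
open import Defs

private
  variable
    a ℓ ℓ′ ℓ″ : Level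
    A : Set a

length-filter-∷ : {P : Pred A ℓ} (P? : Decidable P) (x : A) (xs : List A) →
  length (filter P? xs) ≤ length (filter P? (x ∷ xs))
length-filter-∷ P? x xs with does (P? x)
... | true  = n≤1+n _
... | false = ≤-refl

length-filter-cover : {P : Pred A ℓ} {Q : Pred A ℓ′} {R : Pred A ℓ″}
  (P? : Decidable P) (Q? : Decidable Q) (R? : Decidable R) →
  (∀ {x} → P x → Q x ⊎ R x) → (xs : List A) →
  length (filter P? xs) ≤ length (filter Q? xs) + length (filter R? xs)
length-filter-cover P? Q? R? cover [] = z≤n
length-filter-cover P? Q? R? cover (x ∷ xs) with rest ← length-filter-cover P? Q? R? cover xs | P? x
... | no _   = ≤-trans rest (+-mono-≤ (length-filter-∷ Q? x xs) (length-filter-∷ R? x xs))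
... | yes px with cover px
...   | inj₁ qx rewrite filter-accept Q? {xs = xs} qx =
  s≤s (≤-trans rest (+-monoʳ-≤ _ (length-filter-∷ R? x xs)))
...   | inj₂ rx rewrite filter-accept R? {xs = xs} rx | +-suc (length (filter Q? (x ∷ xs))) (length (filter R? xs)) =
  s≤s (≤-trans rest (+-monoˡ-≤ _ (length-filter-∷ Q? x xs)))

length-concat-≥ : (m : ℕ) (xs : List (List A)) → All (λ u → m ≤ length u) xs →
  m * length xs ≤ length (concat xs)
length-concat-≥ m [] [] = ≤-reflexive (*-zeroʳ m)
length-concat-≥ m (x ∷ xs) (m≤x ∷ m≤xs) = begin
  m * suc (length xs)           ≡⟨ *-suc m (length xs) ⟩
  m + m * length xs             ≤⟨ +-mono-≤ m≤x (length-concat-≥ m xs m≤xs) ⟩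
  length x + length (concat xs) ≡⟨ sym (length-++ x) ⟩
  length (x ++ concat xs)       ∎
  where open ≤-Reasoning

length-concat-filter : {P : Pred (List A) ℓ} (P? : Decidable P) (xs : List (List A)) →
  length (concat (filter P? xs)) ≤ length (concat xs)
length-concat-filter P? [] = z≤n
length-concat-filter P? (x ∷ xs) with does (P? x)
... | true  rewrite length-++ x {concat (filter P? xs)} | length-++ x {concat xs} =
  +-monoʳ-≤ (length x) (length-concat-filter P? xs)
... | false rewrite length-++ x {concat xs} =
  ≤-trans (length-concat-filter P? xs) (m≤n+m _ (length x))

ofLength? : (i : ℕ) → Decidable (λ (u : Word) → length u ≡ i)
ofLength? i u = length u ≟ i

longer? : (k : ℕ) → Decidable (λ (u : Word) → k < length u)
longer? k u = k <? length u

longWords : ℕ → List Word → List Word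
longWords k = filter (longer? k)

longWords-weight : (k : ℕ) (us : List Word) →
  suc k * length (longWords k us) ≤ length (concat us)
longWords-weight k us =
  ≤-trans (length-concat-≥ (suc k) (longWords k us) (AllP.all-filter (longer? k) us))
          (length-concat-filter (longer? k) us)

longer-cover : {k : ℕ} {u : Word} → k < length u → length u ≡ suc k ⊎ suc k < length u
longer-cover k<u with m≤n⇒m<n∨m≡n k<u
... | inj₁ k+1<u = inj₂ k+1<u
... | inj₂ k+1≡u = inj₁ (sym k+1≡u)

module Counting (N : ℕ) (F : Word → Set) (F∌ε : ¬ F []) (perLength : AtMostPerLength N F)
                (us : List Word) (Fus : All F us) (uniq : Unique us) where

  ofLength-bound : (i : ℕ) → 1 ≤ i → length (filter (ofLength? i) us) ≤ N
  ofLength-bound i 1≤i = perLength i 1≤i (filter (ofLength? i) us)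
    (Unique.filter⁺ (ofLength? i) uniq)
    (zip (AllP.filter⁺ (ofLength? i) Fus , AllP.all-filter (ofLength? i) us))

  nonEmpty : ∀ {u} → F u → 0 < length u
  nonEmpty {[]}    Fε = contradiction Fε F∌ε
  nonEmpty {_ ∷ _} _  = s≤s z≤n

  -- Passing from threshold k to k + 1 turns at most N long factors (those of
  -- length exactly k + 1) into short ones.
  fewShort : (k : ℕ) → length us ≤ N * k + length (longWords k us)
  fewShort zero rewrite filter-all (longer? 0) (All.map nonEmpty Fus) | *-zeroʳ N = ≤-refl
  fewShort (suc k) = begin
    length us                                                ≤⟨ fewShort k ⟩
    N * k + length (longWords k us)                          ≤⟨ +-monoʳ-≤ (N * k) split ⟩
    N * k + (length (filter (ofLength? (suc k)) us) + long′) ≤⟨ +-monoʳ-≤ (N * k) (+-monoˡ-≤ long′ (ofLength-bound (suc k) (s≤s z≤n))) ⟩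
    N * k + (N + long′)                                      ≡⟨ sym (+-assoc (N * k) N long′) ⟩
    N * k + N + long′                                        ≡⟨ cong (_+ long′) (+-comm (N * k) N) ⟩
    N + N * k + long′                                        ≡⟨ cong (_+ long′) (sym (*-suc N k)) ⟩
    N * suc k + long′                                        ∎
    where
      open ≤-Reasoning
      long′ : ℕ
      long′ = length (longWords (suc k) us)
      split : length (longWords k us) ≤ length (filter (ofLength? (suc k)) us) + long′
      split = length-filter-cover (longer? k) (ofLength? (suc k)) (longer? (suc k))
                (λ {u} → longer-cover {u = u}) us

-- The arithmetic heart: for r ≤ 2N, (2N·k + r)² ≤ 4N·(k + 1)·(N·k + r),
-- because the difference is 4N²k + r·(4N − r) ≥ 0.
square-bound : (N k r : ℕ) → r ≤ 2 * N →
  (r + k * (2 * N)) * (r + k * (2 * N)) ≤ 4 * N * (suc k * (N * k + r))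
square-bound N k r r≤2N = begin
  (r + k * (2 * N)) * (r + k * (2 * N))                   ≡⟨ expand-square N k r ⟩
  (4 * N * N * k * k + 4 * N * k * r) + r * r             ≤⟨ +-mono-≤ (m≤m+n _ (4 * N * N * k)) r²≤4Nr ⟩
  (4 * N * N * k * k + 4 * N * k * r + 4 * N * N * k) + 4 * N * r ≡⟨ expand-product N k r ⟩
  4 * N * (suc k * (N * k + r))                           ∎
  where
    open ≤-Reasoning
    expand-square : ∀ N k r → (r + k * (2 * N)) * (r + k * (2 * N)) ≡ (4 * N * N * k * k + 4 * N * k * r) + r * r
    expand-square = solve-∀
    expand-product : ∀ N k r → (4 * N * N * k * k + 4 * N * k * r + 4 * N * N * k) + 4 * N * r ≡ 4 * N * (suc k * (N * k + r))
    expand-product = solve-∀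
    r²≤4Nr : r * r ≤ 4 * N * r
    r²≤4Nr = *-monoˡ-≤ r (≤-trans r≤2N (*-monoˡ-≤ N {2} {4} (s≤s (s≤s z≤n))))

mainTheorem6 : (N : ℕ) → 1 ≤ N → (F : Word → Set) → ¬ F [] → AtMostPerLength N F →
    (w : Word) (us : List Word) → All F us → Unique us → w ≡ concat us →
    length us * length us ≤ 4 * N * length w
mainTheorem6 N@(suc _) _ F F∌ε perLength w us Fus uniq refl = begin
  t * t                                       ≡⟨ cong (λ m → m * m) t≡r+k·2N ⟩
  (r + k * (2 * N)) * (r + k * (2 * N))       ≤⟨ square-bound N k r (<⇒≤ (m%n<n t (2 * N))) ⟩
  4 * N * (suc k * (N * k + r))               ≤⟨ *-monoʳ-≤ (4 * N) (*-monoʳ-≤ (suc k) manyLong) ⟩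
  4 * N * (suc k * length (longWords k us))   ≤⟨ *-monoʳ-≤ (4 * N) (longWords-weight k us) ⟩
  4 * N * length (concat us)                  ∎
  where
    open ≤-Reasoning
    open Counting N F F∌ε perLength us Fus uniq
    t k r : ℕ
    t = length us
    k = t / (2 * N)
    r = t % (2 * N)
    t≡r+k·2N : t ≡ r + k * (2 * N)
    t≡r+k·2N = m≡m%n+[m/n]*n t (2 * N)
    -- t = 2N·k + r ≤ N·k + #long, so at least N·k + r factors are long.
    manyLong : N * k + r ≤ length (longWords k us)
    manyLong = +-cancelˡ-≤ (N * k) _ _ (≤-trans (≤-reflexive (trans (regroup N k r) (sym t≡r+k·2N))) (fewShort k))
      where
        regroup : ∀ N k r → N * k + (N * k + r) ≡ r + k * (2 * N)
        regroup = solve-∀
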